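{- Let $G$ be a proper circular-arc graph with non-bipartite complement, let $\prec$ be an arc ordering of $\mathcal{N}[G]$, and for each vertex $w$ write $N[w]=[w^-,w^+]$. Then for all vertices $u,v$: (1) $v\in[u,u^+]$ if and only if $u\in[v^-,v]$. (2) If $v\in[u,u^+]$, then $v^-\in[u^-,u]$ and $u^+\in[v,v^+]$. (3) If $v$ is the immediate successor of $u$ in $\prec$ and $u,v$ are adjacent, then going once around the circle the vertices $u^-,v^-,u,v,u^+,v^+$ occur in exactly this circular order, where cyclically consecutive entries of this list may coincide except that $v^+\neq u^-$; moreover, $u^-$ is not the immediate successor of $v^+$.
   Context: $\mathcal{N}[G]$ is the hypergraph on $V(G)$ whose hyperedges are the closed neighborhoods $N[w]$. A PCA graph is one having a representation by arcs of a circle, adjacency meaning intersection, in which no arc is contained in another. An arc ordering is a circular ordering of $V(G)$ (given by an immediate-successor relation $x\prec y$) in which every hyperedge is a set of circularly consecutive vertices. For $a,b\in V(G)$, $[a,b]$ denotes the set of vertices met going forward from $a$ to $b$. For such $G$ no vertex is universal, so each $N[w]$ is a proper nonempty arc and its first vertex $w^-$ and last vertex $w^+$ are uniquely determined.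
   Formalization: The arcs representing G as a proper circular-arc graph have rational endpoints, lying on a circle taken as the rational points of [0,1). -}

module Defs where

open import Level using (0ℓ)
open import Data.Nat as ℕ using (ℕ; _≤ᵇ_; _∸_; _+_)
open import Data.Bool using (if_then_else_)
open import Data.Fin using (Fin; toℕ)
open import Data.Rational using (ℚ; 0ℚ; 1ℚ) renaming (_≤_ to _≤ℚ_; _<_ to _<ℚ_)
open import Data.Product using (Σ; ∃; _×_; _,_; proj₁; proj₂)
open import Data.Sum using (_⊎_)
open import Relation.Nullary using (¬_)
open import Relation.Binary.PropositionalEquality using (_≡_; _≢_)
open import Function.Bundles using (_⇔_; _↔_; Inverse)

record Graph (n : ℕ) : Set₁ where
  field
    Adj    : Fin n → Fin n → Set
    sym    : ∀ {u v} → Adj u v → Adj v u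
    irrefl : ∀ {u} → ¬ Adj u u
open Graph public

_∈N[_]_ : ∀ {n} → Fin n → Graph n → Fin n → Set
x ∈N[ G ] w = (x ≡ w) ⊎ Adj G w x

CoAdj : ∀ {n} → Graph n → Fin n → Fin n → Set
CoAdj G u v = (u ≢ v) × ¬ Adj G u v

IsBipartite : ∀ {n} → (Fin n → Fin n → Set) → Set
IsBipartite {n} R = Σ (Fin n → Fin 2) λ c → ∀ u v → R u v → c u ≢ c v

-- Closed arcs of the circle ℝ/ℤ, represented by [0,1); endpoints
-- rational.  The arc (a , b) goes counterclockwise from
-- a to b (wrapping through 0 when b < a).

OnCircle : ℚ → Set
OnCircle p = (0ℚ ≤ℚ p) × (p <ℚ 1ℚ)

Arc : Set
Arc = ℚ × ℚ

ValidArc : Arc → Set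
ValidArc (a , b) = OnCircle a × OnCircle b

_∈Arc_ : ℚ → Arc → Set
p ∈Arc (a , b) = ((a ≤ℚ b) × (a ≤ℚ p) × (p ≤ℚ b))
               ⊎ ((b <ℚ a) × ((a ≤ℚ p) ⊎ (p ≤ℚ b)))

ArcsIntersect : Arc → Arc → Set
ArcsIntersect A B = ∃ λ p → OnCircle p × p ∈Arc A × p ∈Arc B

ArcSubset : Arc → Arc → Set
ArcSubset A B = ∀ p → OnCircle p → p ∈Arc A → p ∈Arc B

IsPCA : ∀ {n} → Graph n → Set
IsPCA {n} G = Σ (Fin n → Arc) λ arc →
    (∀ v → ValidArc (arc v))
  × (∀ u v → u ≢ v → (Adj G u v ⇔ ArcsIntersect (arc u) (arc v)))
  × (∀ u v → u ≢ v → ¬ ArcSubset (arc u) (arc v))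

-- Circular orderings of Fin n, given by a position bijection.
-- The immediate successor of x is the vertex at position pos x + 1 (mod n).

CircOrder : ℕ → Set
CircOrder n = Fin n ↔ Fin n

pos : ∀ {n} → CircOrder n → Fin n → ℕ
pos σ x = toℕ (Inverse.to σ x)

fdist : ℕ → ℕ → ℕ → ℕ
fdist n i j = if i ≤ᵇ j then j ∸ i else (n ∸ i) + j

dist : ∀ {n} → CircOrder n → Fin n → Fin n → ℕ
dist {n} σ a b = fdist n (pos σ a) (pos σ b)

-- x ∈ [a , b]: x is met going forward from a to b
_∈[_,_]⟨_⟩ : ∀ {n} → Fin n → Fin n → Fin n → CircOrder n → Set
x ∈[ a , b ]⟨ σ ⟩ = dist σ a x ℕ.≤ dist σ a b

-- x ≺ y : y is the immediate successor of x
_≺_⟨_⟩ : ∀ {n} → Fin n → Fin n → CircOrder n → Set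
x ≺ y ⟨ σ ⟩ = dist σ x y ≡ 1

IsArcOrdering : ∀ {n} → Graph n → CircOrder n → Set
IsArcOrdering {n} G σ = ∀ w → ∃ λ (ab : Fin n × Fin n) →
  ∀ x → (x ∈N[ G ] w) ⇔ (x ∈[ proj₁ ab , proj₂ ab ]⟨ σ ⟩)

-- wm w = w⁻ , wp w = w⁺ : N[w] = [w⁻ , w⁺]
NeighArcs : ∀ {n} → Graph n → CircOrder n → (Fin n → Fin n) → (Fin n → Fin n) → Set
NeighArcs G σ wm wp = ∀ w x → (x ∈N[ G ] w) ⇔ (x ∈[ wm w , wp w ]⟨ σ ⟩)

{-# OPTIONS --safe #-}
-- The hypothesis on the complement is used only in the form "V(G) is not the union of two
-- cliques". For a fixed vertex p, the vertices x with [x,p] ⊆ N[x] form a clique, and so do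
-- those with [p,x] ⊆ N[x]. Hence there are no distinct u, v with [u,v] ⊆ N[u] and
-- [v,u] ⊆ N[v]: the vertices of [u,v] see u, the others see v, and sorting them by the
-- direction in which their neighbourhood reaches u or v covers V(G) by two such cliques.
-- This obstruction gives (1) and (2); reversing the circle exchanges w⁻ and w⁺ and yields the
-- mirror-image statements. Each claim of (3) is proved by exhibiting the same kind of
-- two-clique cover when the claim fails. The facts about circular intervals involve at most
-- five points and are verified by evaluating them on all order types of five points.
module Submission where

open import Data.Bool using (true; false; if_then_else_)
open import Data.Empty using (⊥; ⊥-elim)
open import Data.Fin as Fin using (Fin; toℕ; fromℕ<)
import Data.Fin.Properties as Fin
open import Data.Fin.Subset as Subset using (Subset; inside; outside; ⊤; ∣_∣; _⊆_; _⊂_)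
open import Data.Fin.Subset.Properties using (∈⊤; ∣⊤∣≡n; p⊆q⇒∣p∣≤∣q∣; p⊂q⇒∣p∣<∣q∣)
open import Data.Nat as ℕ using (ℕ; zero; suc; _≤_; _<_; _≰_; _≤?_; _<?_; _≤ᵇ_; _∸_; _+_; s≤s)
import Data.Nat.Properties as ℕ
open import Data.Product using (_×_; _,_; proj₂; map₂; swap)
open import Data.Product.Function.NonDependent.Propositional using (_×-⇔_)
open import Data.Sum as Sum using (_⊎_; inj₁; inj₂)
open import Data.Sum.Function.Propositional using (_⊎-⇔_)
open import Data.Unit using (tt)
open import Data.Vec using (Vec; []; _∷_; lookup; map; tabulate; allFin)
open import Data.Vec.N-ary using (N-ary; _$ⁿ_)
open import Data.Vec.Properties using (lookup-map; lookup∘tabulate; []=⇒lookup; lookup⇒[]=)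
open import Function using (id; _∘_; _∘′_; const)
open import Function.Bundles using (_⇔_; mk⇔; Equivalence; Inverse; Injection; mk↔ₛ′)
open import Function.Construct.Composition using (_⇔-∘_; _↔-∘_)
open import Function.Properties.Equivalence using () renaming (sym to ⇔-sym; trans to ⇔-trans)
open import Function.Properties.Inverse using (↔⇒↣)
open import Function.Related.TypeIsomorphisms using (→-cong-⇔; ¬-cong-⇔)
open import Relation.Nullary using (¬_; Dec; yes; no; does; ¬?)
open import Relation.Nullary.Decidable using (True; toWitness; toSum; map′; _×-dec_; _⊎-dec_; _→-dec_)
open import Relation.Binary.PropositionalEquality using (_≡_; _≢_; refl; sym; trans; cong; subst)

open import Defs using ( Graph; Adj; _∈N[_]_; CoAdj; IsBipartite; IsPCA; CircOrder; pos; fdist; dist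
                       ; _∈[_,_]⟨_⟩; _≺_⟨_⟩; IsArcOrdering; NeighArcs )

open Equivalence using (to; from)

private
  variable
    k n i j l i′ j′ l′ : ℕ

infix 4 _∈ᶜ[_,_]
_∈ᶜ[_,_] : ℕ → ℕ → ℕ → Set
l ∈ᶜ[ i , j ] = (i ≤ j × i ≤ l × l ≤ j) ⊎ (i ≰ j × (i ≤ l ⊎ l ≤ j))

_∈ᶜ?[_,_] : ∀ l i j → Dec (l ∈ᶜ[ i , j ])
l ∈ᶜ?[ i , j ] = (i ≤? j ×-dec i ≤? l ×-dec l ≤? j) ⊎-dec (¬? (i ≤? j) ×-dec (i ≤? l ⊎-dec l ≤? j))

∈ᶜ-cong : i ≤ j ⇔ i′ ≤ j′ → i ≤ l ⇔ i′ ≤ l′ → l ≤ j ⇔ l′ ≤ j′ → l ∈ᶜ[ i , j ] ⇔ l′ ∈ᶜ[ i′ , j′ ]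
∈ᶜ-cong ij il lj = (ij ×-⇔ il ×-⇔ lj) ⊎-⇔ (¬-cong-⇔ ij ×-⇔ (il ⊎-⇔ lj))

∈ᶜ-reverse : i ≤ j ⇔ j′ ≤ i′ → i ≤ l ⇔ l′ ≤ i′ → l ≤ j ⇔ j′ ≤ l′ → l ∈ᶜ[ i , j ] ⇔ l′ ∈ᶜ[ j′ , i′ ]
∈ᶜ-reverse ij il lj =
  mk⇔ swap-middle swap-middle ⇔-∘ ((ij ×-⇔ il ×-⇔ lj) ⊎-⇔ (¬-cong-⇔ ij ×-⇔ (il ⊎-⇔ lj)))
  where
  swap-middle : ∀ {A B C : Set} → (A × B × C) ⊎ (¬ A × (B ⊎ C)) → (A × C × B) ⊎ (¬ A × (C ⊎ B))
  swap-middle = Sum.map (map₂ swap) (map₂ Sum.swap)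

fdist-≤ : i ≤ j → fdist n i j ≡ j ∸ i
fdist-≤ {i} {j} i≤j with i ≤ᵇ j | ℕ.≤⇒≤ᵇ i≤j
... | true | _ = refl

fdist-≰ : i ≰ j → fdist n i j ≡ n ∸ i + j
fdist-≰ {i} {j} i≰j with i ≤ᵇ j | ℕ.≤ᵇ⇒≤ i j
... | true  | i≤j = ⊥-elim (i≰j (i≤j tt))
... | false | _   = refl

fdist-refl : ∀ n i → fdist n i i ≡ 0
fdist-refl n i = trans (fdist-≤ (ℕ.≤-refl {i})) (ℕ.n∸n≡0 i)

fdist≤⇔∈ᶜ : j < n → l < n → fdist n i l ≤ fdist n i j ⇔ l ∈ᶜ[ i , j ]
fdist≤⇔∈ᶜ {j} {n} {l} {i} j<n l<n with i ≤? j | i ≤? l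
... | yes i≤j | yes i≤l rewrite fdist-≤ {n = n} i≤j | fdist-≤ {n = n} i≤l = mk⇔
  (λ l∸i≤j∸i → inj₁ (i≤j , i≤l , subst (_≤ j) (ℕ.m∸n+n≡m i≤l) (ℕ.m≤o∸n⇒m+n≤o (l ∸ i) i≤j l∸i≤j∸i)))
  (λ { (inj₁ (_ , _ , l≤j)) → ℕ.∸-monoˡ-≤ i l≤j ; (inj₂ (i≰j , _)) → ⊥-elim (i≰j i≤j) })
... | yes i≤j | no i≰l rewrite fdist-≤ {n = n} i≤j | fdist-≰ {n = n} i≰l = mk⇔
  (λ h → ⊥-elim (ℕ.<⇒≱ (ℕ.<-≤-trans (ℕ.∸-monoˡ-< j<n i≤j) (ℕ.m≤m+n (n ∸ i) l)) h))
  (λ { (inj₁ (_ , i≤l , _)) → ⊥-elim (i≰l i≤l) ; (inj₂ (i≰j , _)) → ⊥-elim (i≰j i≤j) })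
... | no i≰j | yes i≤l rewrite fdist-≰ {n = n} i≰j | fdist-≤ {n = n} i≤l = mk⇔
  (λ _ → inj₂ (i≰j , inj₁ i≤l))
  (λ _ → ℕ.≤-trans (ℕ.∸-monoˡ-≤ i (ℕ.<⇒≤ l<n)) (ℕ.m≤m+n (n ∸ i) j))
... | no i≰j | no i≰l rewrite fdist-≰ {n = n} i≰j | fdist-≰ {n = n} i≰l = mk⇔
  (λ h → inj₂ (i≰j , inj₂ (ℕ.+-cancelˡ-≤ (n ∸ i) l j h)))
  (λ { (inj₁ (i≤j , _)) → ⊥-elim (i≰j i≤j)
     ; (inj₂ (_ , inj₁ i≤l)) → ⊥-elim (i≰l i≤l)
     ; (inj₂ (_ , inj₂ l≤j)) → ℕ.+-monoʳ-≤ (n ∸ i) l≤j })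

infix  7 _∈ᶠ[_,_] _≐_
infix  6 ~_
infixr 5 _∧_
infixr 4 _∨_
infixr 3 _⇒_

data Formula (k : ℕ) : Set where
  _∈ᶠ[_,_]    : (x a b : Fin k) → Formula k
  _≐_         : (x y : Fin k) → Formula k
  ~_          : Formula k → Formula k
  _∧_ _∨_ _⇒_ : Formula k → Formula k → Formula k

⟦_⟧ : Formula k → {A : Set} → (A → A → A → Set) → Vec A k → Set
⟦ x ∈ᶠ[ a , b ] ⟧ B ρ = B (lookup ρ x) (lookup ρ a) (lookup ρ b)
⟦ x ≐ y ⟧         B ρ = lookup ρ x ≡ lookup ρ y
⟦ ~ φ ⟧           B ρ = ¬ ⟦ φ ⟧ B ρ
⟦ φ ∧ ψ ⟧         B ρ = ⟦ φ ⟧ B ρ × ⟦ ψ ⟧ B ρ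
⟦ φ ∨ ψ ⟧         B ρ = ⟦ φ ⟧ B ρ ⊎ ⟦ ψ ⟧ B ρ
⟦ φ ⇒ ψ ⟧         B ρ = ⟦ φ ⟧ B ρ → ⟦ ψ ⟧ B ρ

⟦⟧-cong : ∀ (φ : Formula k) {A A′ : Set} {B : A → A → A → Set} {B′ : A′ → A′ → A′ → Set}
          {ρ : Vec A k} {ρ′ : Vec A′ k} →
          (∀ x a b → B (lookup ρ x) (lookup ρ a) (lookup ρ b) ⇔
                     B′ (lookup ρ′ x) (lookup ρ′ a) (lookup ρ′ b)) →
          (∀ x y → lookup ρ x ≡ lookup ρ y ⇔ lookup ρ′ x ≡ lookup ρ′ y) →
          ⟦ φ ⟧ B ρ ⇔ ⟦ φ ⟧ B′ ρ′
⟦⟧-cong (x ∈ᶠ[ a , b ]) B⇔ ≡⇔ = B⇔ x a b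
⟦⟧-cong (x ≐ y)         B⇔ ≡⇔ = ≡⇔ x y
⟦⟧-cong (~ φ)           B⇔ ≡⇔ = ¬-cong-⇔ (⟦⟧-cong φ B⇔ ≡⇔)
⟦⟧-cong (φ ∧ ψ)         B⇔ ≡⇔ = ⟦⟧-cong φ B⇔ ≡⇔ ×-⇔ ⟦⟧-cong ψ B⇔ ≡⇔
⟦⟧-cong (φ ∨ ψ)         B⇔ ≡⇔ = ⟦⟧-cong φ B⇔ ≡⇔ ⊎-⇔ ⟦⟧-cong ψ B⇔ ≡⇔
⟦⟧-cong (φ ⇒ ψ)         B⇔ ≡⇔ = →-cong-⇔ (⟦⟧-cong φ B⇔ ≡⇔) (⟦⟧-cong ψ B⇔ ≡⇔)

⟦_⟧? : (φ : Formula k) (ρ : Vec ℕ k) → Dec (⟦ φ ⟧ _∈ᶜ[_,_] ρ)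
⟦ x ∈ᶠ[ a , b ] ⟧? ρ = lookup ρ x ∈ᶜ?[ lookup ρ a , lookup ρ b ]
⟦ x ≐ y ⟧?         ρ = lookup ρ x ℕ.≟ lookup ρ y
⟦ ~ φ ⟧?           ρ = ¬? (⟦ φ ⟧? ρ)
⟦ φ ∧ ψ ⟧?         ρ = ⟦ φ ⟧? ρ ×-dec ⟦ ψ ⟧? ρ
⟦ φ ∨ ψ ⟧?         ρ = ⟦ φ ⟧? ρ ⊎-dec ⟦ ψ ⟧? ρ
⟦ φ ⇒ ψ ⟧?         ρ = ⟦ φ ⟧? ρ →-dec ⟦ ψ ⟧? ρ

-- It suffices to check assignments into Fin k: replacing each value by its rank
-- (`Rank.normalise`) preserves the order type, hence the truth of every formula.
Valid : Formula k → Set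
Valid {k} φ = ∀ (v : Vec (Fin k) k) → ⟦ φ ⟧ _∈ᶜ[_,_] (map toℕ v)

∀-vec? : ∀ {m} k {P : Vec (Fin m) k → Set} → (∀ v → Dec (P v)) → Dec (∀ v → P v)
∀-vec? zero    P? = map′ (λ p → λ { [] → p }) (λ h → h []) (P? [])
∀-vec? (suc k) P? = map′ (λ h → λ { (x ∷ v) → h x v }) (λ h x v → h (x ∷ v))
                         (Fin.all? λ x → ∀-vec? k λ v → P? (x ∷ v))

valid? : (φ : Formula k) → Dec (Valid φ)
valid? {k} φ = ∀-vec? k (λ v → ⟦ φ ⟧? (map toℕ v))

module Rank (ρ : Vec ℕ k) where

  below : ℕ → Subset k
  below m = tabulate λ j → if does (lookup ρ j <? m) then inside else outside

  ∈-below : ∀ {j m} → j Subset.∈ below m ⇔ lookup ρ j < m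
  ∈-below {j} {m} = side⇔ (lookup ρ j <? m) ⇔-∘ mk⇔
      (λ j∈ → trans (sym (lookup∘tabulate _ j)) ([]=⇒lookup j∈))
      (λ eq → lookup⇒[]= j _ (trans (lookup∘tabulate _ j) eq))
    where
    side⇔ : ∀ {A : Set} (a? : Dec A) → (if does a? then inside else outside) ≡ inside ⇔ A
    side⇔ (yes a) = mk⇔ (const a) (const refl)
    side⇔ (no ¬a) = mk⇔ (λ ()) (⊥-elim ∘ ¬a)

  rank : Fin k → ℕ
  rank i = ∣ below (lookup ρ i) ∣

  below-⊂ : ∀ {i} {p : Subset k} → below (lookup ρ i) ⊆ p → i Subset.∈ p → below (lookup ρ i) ⊂ p
  below-⊂ {i} below⊆p i∈p = below⊆p , i , i∈p , ℕ.<-irrefl refl ∘ to ∈-below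

  rank<k : ∀ i → rank i < k
  rank<k i = subst (rank i <_) (∣⊤∣≡n k) (p⊂q⇒∣p∣<∣q∣ (below-⊂ (const ∈⊤) ∈⊤))

  ≤⇔rank≤ : ∀ i j → lookup ρ i ≤ lookup ρ j ⇔ rank i ≤ rank j
  ≤⇔rank≤ i j = mk⇔
    (λ ρi≤ρj → p⊆q⇒∣p∣≤∣q∣ (λ x∈ → from ∈-below (ℕ.<-≤-trans (to ∈-below x∈) ρi≤ρj)))
    (λ ri≤rj → ℕ.≮⇒≥ λ ρj<ρi → ℕ.<⇒≱ (p⊂q⇒∣p∣<∣q∣
      (below-⊂ (λ x∈ → from ∈-below (ℕ.<-trans (to ∈-below x∈) ρj<ρi)) (from ∈-below ρj<ρi))) ri≤rj)

  normalise : Vec (Fin k) k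
  normalise = tabulate λ i → fromℕ< (rank<k i)

  lookup-normalise : ∀ i → lookup (map toℕ normalise) i ≡ rank i
  lookup-normalise i = trans (lookup-map i toℕ normalise)
                             (trans (cong toℕ (lookup∘tabulate _ i)) (Fin.toℕ-fromℕ< (rank<k i)))

same-order⇒⟦⟧⇔ : ∀ (φ : Formula k) {ρ ρ′ : Vec ℕ k} →
                 (∀ x y → lookup ρ x ≤ lookup ρ y ⇔ lookup ρ′ x ≤ lookup ρ′ y) →
                 ⟦ φ ⟧ _∈ᶜ[_,_] ρ ⇔ ⟦ φ ⟧ _∈ᶜ[_,_] ρ′
same-order⇒⟦⟧⇔ φ {ρ} {ρ′} ≤⇔ = ⟦⟧-cong φ (λ x a b → ∈ᶜ-cong (≤⇔ a b) (≤⇔ a x) (≤⇔ x b)) ≡⇔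
  where
  ≡⇔ : ∀ x y → lookup ρ x ≡ lookup ρ y ⇔ lookup ρ′ x ≡ lookup ρ′ y
  ≡⇔ x y = mk⇔
    (λ eq → ℕ.≤-antisym (to (≤⇔ x y) (ℕ.≤-reflexive eq)) (to (≤⇔ y x) (ℕ.≤-reflexive (sym eq))))
    (λ eq → ℕ.≤-antisym (from (≤⇔ x y) (ℕ.≤-reflexive eq)) (from (≤⇔ y x) (ℕ.≤-reflexive (sym eq))))

valid⇒⟦⟧ : ∀ (φ : Formula k) → Valid φ → ∀ ρ → ⟦ φ ⟧ _∈ᶜ[_,_] ρ
valid⇒⟦⟧ φ valid ρ = from (same-order⇒⟦⟧⇔ φ ≤⇔) (valid normalise)
  where
  open Rank ρ
  ≤⇔ : ∀ x y → lookup ρ x ≤ lookup ρ y ⇔ lookup (map toℕ normalise) x ≤ lookup (map toℕ normalise) y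
  ≤⇔ x y rewrite lookup-normalise x | lookup-normalise y = ≤⇔rank≤ x y


module _ {n} (σ : CircOrder n) where

  pos<n : ∀ x → pos σ x < n
  pos<n x = Fin.toℕ<n (Inverse.to σ x)

  pos-injective : ∀ {x y} → pos σ x ≡ pos σ y → x ≡ y
  pos-injective = Injection.injective (↔⇒↣ σ) ∘ Fin.toℕ-injective

  ∈⇔∈ᶜ : ∀ {x a b} → x ∈[ a , b ]⟨ σ ⟩ ⇔ pos σ x ∈ᶜ[ pos σ a , pos σ b ]
  ∈⇔∈ᶜ {x} {b = b} = fdist≤⇔∈ᶜ (pos<n b) (pos<n x)

  holds : ∀ k (φ : N-ary k (Fin k) (Formula k)) → {True (valid? (φ $ⁿ allFin k))} →
          (ρ : Vec (Fin n) k) → ⟦ φ $ⁿ allFin k ⟧ (λ x a b → x ∈[ a , b ]⟨ σ ⟩) ρ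
  holds k φ {valid} ρ =
    from (⟦⟧-cong (φ $ⁿ allFin k) {B′ = _∈ᶜ[_,_]} {ρ′ = positions} ∈⇔ ≡⇔)
         (valid⇒⟦⟧ (φ $ⁿ allFin k) (toWitness valid) positions)
    where
    positions : Vec ℕ k
    positions = map (pos σ) ρ

    ∈⇔ : ∀ x a b → lookup ρ x ∈[ lookup ρ a , lookup ρ b ]⟨ σ ⟩ ⇔
                   lookup positions x ∈ᶜ[ lookup positions a , lookup positions b ]
    ∈⇔ x a b rewrite lookup-map x (pos σ) ρ | lookup-map a (pos σ) ρ | lookup-map b (pos σ) ρ = ∈⇔∈ᶜ

    ≡⇔ : ∀ x y → lookup ρ x ≡ lookup ρ y ⇔ lookup positions x ≡ lookup positions y
    ≡⇔ x y rewrite lookup-map x (pos σ) ρ | lookup-map y (pos σ) ρ = mk⇔ (cong (pos σ)) pos-injective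

reverse : ∀ {n} → CircOrder n → CircOrder n
reverse σ = mk↔ₛ′ Fin.opposite Fin.opposite Fin.opposite-involutive Fin.opposite-involutive ↔-∘ σ

∈⟨⟩-reverse : ∀ {n} {σ : CircOrder n} {x a b} → x ∈[ a , b ]⟨ reverse σ ⟩ ⇔ x ∈[ b , a ]⟨ σ ⟩
∈⟨⟩-reverse {n} {σ} {x} {a} {b} =
  ⇔-trans (∈⇔∈ᶜ (reverse σ))
          (⇔-trans (∈ᶜ-reverse (≤-opposite a b) (≤-opposite a x) (≤-opposite x b)) (⇔-sym (∈⇔∈ᶜ σ)))
  where
  ≤-opposite : ∀ y z → pos (reverse σ) y ≤ pos (reverse σ) z ⇔ pos σ z ≤ pos σ y
  ≤-opposite y z rewrite Fin.opposite-prop (Inverse.to σ y) | Fin.opposite-prop (Inverse.to σ z) = mk⇔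
    (λ h → ℕ.s≤s⁻¹ (ℕ.∸-cancelʳ-≤ (pos<n σ z) h))
    (λ h → ℕ.∸-monoʳ-≤ n (s≤s h))

module Arcs {n} (σ : CircOrder n) where

  private
    variable
      a b c m p q u v w x y z : Fin n

  infix 4 _∈[_,_] _∉[_,_]

  -- Opaque, so that unification treats x ∈[ a , b ] as rigid in x, a and b: the underlying
  -- comparison of distances does not determine them, and implicit arguments would stay unsolved.
  opaque
    _∈[_,_] : Fin n → Fin n → Fin n → Set
    x ∈[ a , b ] = x ∈[ a , b ]⟨ σ ⟩

  _∉[_,_] : Fin n → Fin n → Fin n → Set
  x ∉[ a , b ] = ¬ x ∈[ a , b ]

  Consecutive : Fin n → Fin n → Set
  Consecutive u v = ∀ {z} → z ∈[ u , v ] → z ≡ u ⊎ z ≡ v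

  ≺⇒≢ : u ≺ v ⟨ σ ⟩ → u ≢ v
  ≺⇒≢ {u} u≺v refl with trans (sym u≺v) (fdist-refl n (pos σ u))
  ... | ()

  opaque
    unfolding _∈[_,_]

    ∈⇔∈⟨σ⟩ : x ∈[ a , b ] ⇔ x ∈[ a , b ]⟨ σ ⟩
    ∈⇔∈⟨σ⟩ = mk⇔ id id

    _∈?[_,_] : ∀ x a b → Dec (x ∈[ a , b ])
    x ∈?[ a , b ] = dist σ a x ≤? dist σ a b

    a∈[a,b] : a ∈[ a , b ]
    a∈[a,b] {a} {b} = holds σ 2 (λ a b → a ∈ᶠ[ a , b ]) (a ∷ b ∷ [])

    b∈[a,b] : b ∈[ a , b ]
    b∈[a,b] {b} {a} = holds σ 2 (λ a b → b ∈ᶠ[ a , b ]) (a ∷ b ∷ [])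

    x∈[a,a]⇒x≡a : x ∈[ a , a ] → x ≡ a
    x∈[a,a]⇒x≡a {x} {a} = holds σ 2 (λ x a → x ∈ᶠ[ a , a ] ⇒ x ≐ a) (x ∷ a ∷ [])

    ∈-antisym : c ∈[ a , b ] → b ∈[ a , c ] → c ≡ b
    ∈-antisym {c} {a} {b} = holds σ 3 (λ a b c → c ∈ᶠ[ a , b ] ⇒ b ∈ᶠ[ a , c ] ⇒ c ≐ b) (a ∷ b ∷ c ∷ [])

    prefix-⊆ : c ∈[ a , b ] → x ∈[ a , c ] → x ∈[ a , b ]
    prefix-⊆ {c} {a} {b} {x} =
      holds σ 4 (λ a b c x → c ∈ᶠ[ a , b ] ⇒ x ∈ᶠ[ a , c ] ⇒ x ∈ᶠ[ a , b ]) (a ∷ b ∷ c ∷ x ∷ [])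

    suffix-⊆ : c ∈[ a , b ] → x ∈[ c , b ] → x ∈[ a , b ]
    suffix-⊆ {c} {a} {b} {x} =
      holds σ 4 (λ a b c x → c ∈ᶠ[ a , b ] ⇒ x ∈ᶠ[ c , b ] ⇒ x ∈ᶠ[ a , b ]) (a ∷ b ∷ c ∷ x ∷ [])

    ∈-split : c ∈[ a , b ] → x ∈[ a , b ] → x ∈[ a , c ] ⊎ x ∈[ c , b ]
    ∈-split {c} {a} {b} {x} =
      holds σ 4 (λ a b c x → c ∈ᶠ[ a , b ] ⇒ x ∈ᶠ[ a , b ] ⇒ x ∈ᶠ[ a , c ] ∨ x ∈ᶠ[ c , b ])
        (a ∷ b ∷ c ∷ x ∷ [])

    ∈-total-from : ∀ a x y → y ∈[ a , x ] ⊎ x ∈[ a , y ]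
    ∈-total-from a x y = holds σ 3 (λ a x y → y ∈ᶠ[ a , x ] ∨ x ∈ᶠ[ a , y ]) (a ∷ x ∷ y ∷ [])

    ∈-total-to : ∀ b x y → y ∈[ x , b ] ⊎ x ∈[ y , b ]
    ∈-total-to b x y = holds σ 3 (λ b x y → y ∈ᶠ[ x , b ] ∨ x ∈ᶠ[ y , b ]) (b ∷ x ∷ y ∷ [])

    ∉⇒∈-opposite : u ≢ v → x ∉[ u , v ] → x ∈[ v , u ]
    ∉⇒∈-opposite {u} {v} {x} =
      holds σ 3 (λ u v x → ~ u ≐ v ⇒ ~ x ∈ᶠ[ u , v ] ⇒ x ∈ᶠ[ v , u ]) (u ∷ v ∷ x ∷ [])

    ∉⇒[u,v]⊆[y,v] : y ∉[ u , v ] → x ∈[ u , v ] → x ∈[ y , v ]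
    ∉⇒[u,v]⊆[y,v] {y} {u} {v} {x} =
      holds σ 4 (λ u v x y → ~ y ∈ᶠ[ u , v ] ⇒ x ∈ᶠ[ u , v ] ⇒ x ∈ᶠ[ y , v ]) (u ∷ v ∷ x ∷ y ∷ [])

    ∉⇒∈[x,u] : u ≢ v → x ∈[ u , v ] → x ≢ u → y ∉[ u , v ] → y ∈[ x , u ]
    ∉⇒∈[x,u] {u} {v} {x} {y} =
      holds σ 4 (λ u v x y → ~ u ≐ v ⇒ x ∈ᶠ[ u , v ] ⇒ ~ x ≐ u ⇒ ~ y ∈ᶠ[ u , v ] ⇒ y ∈ᶠ[ x , u ])
        (u ∷ v ∷ x ∷ y ∷ [])

    ∈[u,x]⇒∈[x,v] : x ∈[ w , v ] → u ∈[ w , v ] → v ∈[ u , x ] → x ≢ v → u ∈[ x , v ]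
    ∈[u,x]⇒∈[x,v] {x} {w} {v} {u} =
      holds σ 4 (λ w v x u → x ∈ᶠ[ w , v ] ⇒ u ∈ᶠ[ w , v ] ⇒ v ∈ᶠ[ u , x ] ⇒ ~ x ≐ v ⇒ u ∈ᶠ[ x , v ])
        (w ∷ v ∷ x ∷ u ∷ [])

    ≺⇒consecutive : u ≺ v ⟨ σ ⟩ → Consecutive u v
    ≺⇒consecutive {u} {v} u≺v {z} z∈[u,v] with ℕ.n≤1⇒n≡0∨n≡1 (subst (dist σ u z ≤_) u≺v z∈[u,v])
    ... | inj₁ d≡0 = inj₁ (x∈[a,a]⇒x≡a (ℕ.≤-reflexive (trans d≡0 (sym (fdist-refl n (pos σ u))))))
    ... | inj₂ d≡1 = inj₂ (∈-antisym z∈[u,v] (ℕ.≤-reflexive (trans u≺v (sym d≡1))))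

    consecutive-refl : Consecutive u u
    consecutive-refl = inj₁ ∘ x∈[a,a]⇒x≡a

    ∈[u,m]⇒≡u⊎∈[v,m] : u ≢ v → Consecutive u v → z ∈[ u , m ] → z ≡ u ⊎ z ∈[ v , m ]
    ∈[u,m]⇒≡u⊎∈[v,m] {u} {v} {z} {m} u≢v uv =
      holds σ 4 (λ u v m z → ~ u ≐ v ⇒ (z ∈ᶠ[ u , v ] ⇒ z ≐ u ∨ z ≐ v) ⇒ z ∈ᶠ[ u , m ] ⇒ z ≐ u ∨ z ∈ᶠ[ v , m ])
        (u ∷ v ∷ m ∷ z ∷ []) u≢v uv

    consecutive⇒∈[m,v] : u ∈[ m , p ] → v ∈[ u , p ] → u ≢ v → Consecutive u v → u ∈[ m , v ]
    consecutive⇒∈[m,v] {u} {m} {p} {v} u∈ v∈ u≢v uv =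
      holds σ 4 (λ m p u v → u ∈ᶠ[ m , p ] ⇒ v ∈ᶠ[ u , p ] ⇒ ~ u ≐ v ⇒ (m ∈ᶠ[ u , v ] ⇒ m ≐ u ∨ m ≐ v) ⇒
                             (p ∈ᶠ[ u , v ] ⇒ p ≐ u ∨ p ≐ v) ⇒ u ∈ᶠ[ m , v ])
        (m ∷ p ∷ u ∷ v ∷ []) u∈ v∈ u≢v uv uv

    consecutive⇒∈[v,q] : p ∈[ v , q ] → p ∉[ m , q ] → v ∈[ m , p ] → u ∈[ m , v ] → Consecutive u v →
                         m ∈[ v , q ]
    consecutive⇒∈[v,q] {p} {v} {q} {m} {u} p∈ p∉ v∈ u∈ uv =
      holds σ 5 (λ m p u v q → p ∈ᶠ[ v , q ] ⇒ ~ p ∈ᶠ[ m , q ] ⇒ v ∈ᶠ[ m , p ] ⇒ u ∈ᶠ[ m , v ] ⇒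
                               (m ∈ᶠ[ u , v ] ⇒ m ≐ u ∨ m ≐ v) ⇒ (p ∈ᶠ[ u , v ] ⇒ p ≐ u ∨ p ≐ v) ⇒
                               (q ∈ᶠ[ u , v ] ⇒ q ≐ u ∨ q ≐ v) ⇒ m ∈ᶠ[ v , q ])
        (m ∷ p ∷ u ∷ v ∷ q ∷ []) p∈ p∉ v∈ u∈ uv uv uv

    consecutive-cover : u ≢ v → Consecutive u v → Consecutive q m → u ∈[ m , v ] → v ∈[ m , q ] →
                        ∀ z → z ∈[ m , u ] ⊎ z ∈[ v , q ]
    consecutive-cover {u} {v} {q} {m} u≢v uv qm u∈ v∈ z =
      holds σ 5 (λ m u v q z → ~ u ≐ v ⇒ (z ∈ᶠ[ u , v ] ⇒ z ≐ u ∨ z ≐ v) ⇒ (z ∈ᶠ[ q , m ] ⇒ z ≐ q ∨ z ≐ m) ⇒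
                               u ∈ᶠ[ m , v ] ⇒ v ∈ᶠ[ m , q ] ⇒ z ∈ᶠ[ m , u ] ∨ z ∈ᶠ[ v , q ])
        (m ∷ u ∷ v ∷ q ∷ z ∷ []) u≢v uv qm u∈ v∈

∈-reverse : ∀ {n} {σ : CircOrder n} {x a b} → Arcs._∈[_,_] (reverse σ) x a b ⇔ Arcs._∈[_,_] σ x b a
∈-reverse {σ = σ} {x} {a} {b} =
  ⇔-trans (Arcs.∈⇔∈⟨σ⟩ (reverse σ)) (⇔-trans (∈⟨⟩-reverse {σ = σ} {x} {a} {b}) (⇔-sym (Arcs.∈⇔∈⟨σ⟩ σ)))


module Cliques {n} (G : Graph n) where

  private
    variable
      w x : Fin n
      P Q : Fin n → Set

  infix 4 _∈N[_]

  _∈N[_] : Fin n → Fin n → Set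
  x ∈N[ w ] = x ∈N[ G ] w

  ∈N-refl : w ∈N[ w ]
  ∈N-refl = inj₁ refl

  ∈N-sym : x ∈N[ w ] → w ∈N[ x ]
  ∈N-sym (inj₁ x≡w) = inj₁ (sym x≡w)
  ∈N-sym (inj₂ adj) = inj₂ (Graph.sym G adj)

  IsClique : (Fin n → Set) → Set
  IsClique P = ∀ {x y} → P x → P y → x ∈N[ y ]

  clique-⊆ : (∀ {x} → P x → Q x) → IsClique Q → IsClique P
  clique-⊆ P⊆Q Q-clique px py = Q-clique (P⊆Q px) (P⊆Q py)

  ∪-clique : IsClique P → IsClique Q → (∀ {x y} → P x → Q y → x ∈N[ y ]) →
             IsClique (λ x → P x ⊎ Q x)
  ∪-clique P-clique Q-clique PQ (inj₁ px) (inj₁ py) = P-clique px py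
  ∪-clique P-clique Q-clique PQ (inj₁ px) (inj₂ qy) = PQ px qy
  ∪-clique P-clique Q-clique PQ (inj₂ qx) (inj₁ py) = ∈N-sym (PQ py qx)
  ∪-clique P-clique Q-clique PQ (inj₂ qx) (inj₂ qy) = Q-clique qx qy

  two-cliques⇒co-bipartite : ∀ (P Q : Fin n → Set) → (∀ x → P x ⊎ Q x) →
                             IsClique P → IsClique Q → IsBipartite (CoAdj G)
  two-cliques⇒co-bipartite P Q cover P-clique Q-clique = (λ x → side (cover x)) , proper
    where
    side : ∀ {x} → P x ⊎ Q x → Fin 2
    side (inj₁ _) = Fin.zero
    side (inj₂ _) = Fin.suc Fin.zero

    proper : ∀ u v → CoAdj G u v → side (cover u) ≢ side (cover v)
    proper u v (u≢v , ¬adj) = separated (cover u) (cover v)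
      where
      u∉N[v] : ¬ u ∈N[ v ]
      u∉N[v] (inj₁ u≡v) = u≢v u≡v
      u∉N[v] (inj₂ adj) = ¬adj (Graph.sym G adj)

      separated : (cu : P u ⊎ Q u) (cv : P v ⊎ Q v) → side cu ≢ side cv
      separated (inj₁ pu) (inj₁ pv) _ = u∉N[v] (P-clique pu pv)
      separated (inj₂ qu) (inj₂ qv) _ = u∉N[v] (Q-clique qu qv)
      separated (inj₁ _)  (inj₂ _)  ()
      separated (inj₂ _)  (inj₁ _)  ()

-- Each layer NeighArcsₖ₊₁ may apply NeighArcsₖ to the reversed order, in which w⁻ and w⁺
-- exchange roles.
module NeighArcs₁ {n} {G : Graph n} (¬co-bipartite : ¬ IsBipartite (CoAdj G))
                 (σ : CircOrder n) (wm wp : Fin n → Fin n) (N[w]≡[w⁻,w⁺] : NeighArcs G σ wm wp) where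

  open Arcs σ
  open Cliques G

  private
    variable
      a u v w x : Fin n

  reverse-neighArcs : NeighArcs G (reverse σ) wp wm
  reverse-neighArcs w x = ⇔-trans (N[w]≡[w⁻,w⁺] w x) (⇔-sym (∈⟨⟩-reverse {σ = σ} {x} {wp w} {wm w}))

  ∈N⇒∈[w⁻,w⁺] : x ∈N[ w ] → x ∈[ wm w , wp w ]
  ∈N⇒∈[w⁻,w⁺] {x} {w} = from ∈⇔∈⟨σ⟩ ∘ to (N[w]≡[w⁻,w⁺] w x)

  ∈[w⁻,w⁺]⇒∈N : x ∈[ wm w , wp w ] → x ∈N[ w ]
  ∈[w⁻,w⁺]⇒∈N {x} {w} = from (N[w]≡[w⁻,w⁺] w x) ∘ to ∈⇔∈⟨σ⟩

  w∈[w⁻,w⁺] : w ∈[ wm w , wp w ]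
  w∈[w⁻,w⁺] = ∈N⇒∈[w⁻,w⁺] ∈N-refl

  ∈N-split : x ∈N[ w ] → x ∈[ wm w , w ] ⊎ x ∈[ w , wp w ]
  ∈N-split x∈N[w] = ∈-split w∈[w⁻,w⁺] (∈N⇒∈[w⁻,w⁺] x∈N[w])

  infix 4 [_,_]⊆N[_]

  [_,_]⊆N[_] : Fin n → Fin n → Fin n → Set
  [ a , b ]⊆N[ w ] = ∀ {z} → z ∈[ a , b ] → z ∈N[ w ]

  [w,w]⊆N[w] : [ w , w ]⊆N[ w ]
  [w,w]⊆N[w] = inj₁ ∘ x∈[a,a]⇒x≡a

  ∈[w,w⁺]⇒[w,x]⊆N[w] : x ∈[ w , wp w ] → [ w , x ]⊆N[ w ]
  ∈[w,w⁺]⇒[w,x]⊆N[w] x∈ z∈ = ∈[w⁻,w⁺]⇒∈N (suffix-⊆ w∈[w⁻,w⁺] (prefix-⊆ x∈ z∈))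

  ∈[w⁻,w]⇒[x,w]⊆N[w] : x ∈[ wm w , w ] → [ x , w ]⊆N[ w ]
  ∈[w⁻,w]⇒[x,w]⊆N[w] x∈ z∈ = ∈[w⁻,w⁺]⇒∈N (prefix-⊆ w∈[w⁻,w⁺] (suffix-⊆ x∈ z∈))

  ∈N⇒⊆N : a ∈N[ x ] → [ a , x ]⊆N[ x ] ⊎ [ x , a ]⊆N[ x ]
  ∈N⇒⊆N = Sum.map ∈[w⁻,w]⇒[x,w]⊆N[w] ∈[w,w⁺]⇒[w,x]⊆N[w] ∘ ∈N-split

  reaching-to-clique : ∀ p → IsClique (λ x → [ x , p ]⊆N[ x ])
  reaching-to-clique p {x} {y} [x,p]⊆ [y,p]⊆ = Sum.[ ∈N-sym ∘ [x,p]⊆ , [y,p]⊆ ]′ (∈-total-to p x y)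

  reaching-from-clique : ∀ p → IsClique (λ x → [ p , x ]⊆N[ x ])
  reaching-from-clique p {x} {y} [p,x]⊆ [p,y]⊆ = Sum.[ ∈N-sym ∘ [p,x]⊆ , [p,y]⊆ ]′ (∈-total-from p x y)

  ¬forward-cover : u ≢ v → [ u , v ]⊆N[ u ] → [ v , u ]⊆N[ v ] → ⊥
  ¬forward-cover {u} {v} u≢v [u,v]⊆ [v,u]⊆ =
    ¬co-bipartite (two-cliques⇒co-bipartite P Q cover P-clique Q-clique)
    where
    P₁ P₂ Q₁ Q₂ P Q : Fin n → Set
    P₁ x = x ∈[ u , v ] × [ u , x ]⊆N[ x ]
    P₂ x = x ∉[ u , v ] × [ x , v ]⊆N[ x ]
    Q₁ x = x ∈[ u , v ] × x ≢ u × [ x , u ]⊆N[ x ]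
    Q₂ x = x ∉[ u , v ] × [ v , x ]⊆N[ x ]
    P x = P₁ x ⊎ P₂ x
    Q x = Q₁ x ⊎ Q₂ x

    cover : ∀ x → P x ⊎ Q x
    cover x = Sum.[ cover-∈ , cover-∉ ]′ (toSum (x ∈?[ u , v ]))
      where
      cover-∈ : x ∈[ u , v ] → P x ⊎ Q x
      cover-∈ x∈ = Sum.[ (λ [u,x]⊆ → inj₁ (inj₁ (x∈ , [u,x]⊆))) , reaching-back ]′
                       (∈N⇒⊆N (∈N-sym ([u,v]⊆ x∈)))
        where
        reaching-back : [ x , u ]⊆N[ x ] → P x ⊎ Q x
        reaching-back [x,u]⊆ with x Fin.≟ u
        ... | yes refl = inj₁ (inj₁ (x∈ , [w,w]⊆N[w]))
        ... | no x≢u   = inj₂ (inj₁ (x∈ , x≢u , [x,u]⊆))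

      cover-∉ : x ∉[ u , v ] → P x ⊎ Q x
      cover-∉ x∉ = Sum.[ (λ [v,x]⊆ → inj₂ (inj₂ (x∉ , [v,x]⊆))) , (λ [x,v]⊆ → inj₁ (inj₂ (x∉ , [x,v]⊆))) ]′
                       (∈N⇒⊆N (∈N-sym ([v,u]⊆ (∉⇒∈-opposite u≢v x∉))))

    P-clique : IsClique P
    P-clique = ∪-clique (clique-⊆ {P₁} proj₂ (reaching-from-clique u))
                        (clique-⊆ {P₂} proj₂ (reaching-to-clique v)) mixed
      where
      mixed : ∀ {x y} → P₁ x → P₂ y → x ∈N[ y ]
      mixed (x∈ , _) (y∉ , [y,v]⊆) = [y,v]⊆ (∉⇒[u,v]⊆[y,v] y∉ x∈)

    Q-clique : IsClique Q
    Q-clique = ∪-clique (clique-⊆ {Q₁} (proj₂ ∘′ proj₂) (reaching-to-clique u))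
                        (clique-⊆ {Q₂} proj₂ (reaching-from-clique v)) mixed
      where
      mixed : ∀ {x y} → Q₁ x → Q₂ y → x ∈N[ y ]
      mixed (x∈ , x≢u , [x,u]⊆) (y∉ , _) = ∈N-sym ([x,u]⊆ (∉⇒∈[x,u] u≢v x∈ x≢u y∉))

  ∈[u,u⁺]⇒∈[v⁻,v] : v ∈[ u , wp u ] → u ∈[ wm v , v ]
  ∈[u,u⁺]⇒∈[v⁻,v] {v} {u} v∈ with u Fin.≟ v
  ... | yes refl = b∈[a,b]
  ... | no u≢v   = Sum.[ id , (λ u∈ → ⊥-elim (¬forward-cover u≢v [u,v]⊆ (∈[w,w⁺]⇒[w,x]⊆N[w] u∈))) ]′
                         (∈N-split (∈N-sym ([u,v]⊆ b∈[a,b])))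
    where
    [u,v]⊆ : [ u , v ]⊆N[ u ]
    [u,v]⊆ = ∈[w,w⁺]⇒[w,x]⊆N[w] v∈

module NeighArcs₂ {n} {G : Graph n} (¬co-bipartite : ¬ IsBipartite (CoAdj G))
                 (σ : CircOrder n) (wm wp : Fin n → Fin n) (N[w]≡[w⁻,w⁺] : NeighArcs G σ wm wp) where

  open Arcs σ
  open Cliques G
  open NeighArcs₁ {G = G} ¬co-bipartite σ wm wp N[w]≡[w⁻,w⁺] public

  private
    module Mirror = NeighArcs₁ {G = G} ¬co-bipartite (reverse σ) wp wm reverse-neighArcs
    variable
      u v : Fin n

  ∈[v⁻,v]⇒∈[u,u⁺] : u ∈[ wm v , v ] → v ∈[ u , wp u ]
  ∈[v⁻,v]⇒∈[u,u⁺] {u} {v} u∈ = to ∈-reverse (Mirror.∈[u,u⁺]⇒∈[v⁻,v] {u} {v} (from ∈-reverse u∈))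

  ¬backward-cover : u ≢ v → [ u , v ]⊆N[ v ] → [ v , u ]⊆N[ u ] → ⊥
  ¬backward-cover {u} {v} u≢v [u,v]⊆ [v,u]⊆ =
    Mirror.¬forward-cover (u≢v ∘ sym) (λ z∈ → [u,v]⊆ (to ∈-reverse z∈)) (λ z∈ → [v,u]⊆ (to ∈-reverse z∈))

  ∈[u,u⁺]⇒u⁺∈[v,v⁺] : v ∈[ u , wp u ] → wp u ∈[ v , wp v ]
  ∈[u,u⁺]⇒u⁺∈[v,v⁺] {v} {u} v∈ with u Fin.≟ v | wp u Fin.≟ v
  ... | yes refl | _        = b∈[a,b]
  ... | no _     | yes refl = a∈[a,b]
  ... | no u≢v   | no u⁺≢v  =
    Sum.[ u⁺-reaches-back , ⊥-elim ∘′ ¬[u⁺,u]⊆N[u⁺] ]′ (∈N⇒⊆N u∈N[u⁺])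
    where
    u≢u⁺ : u ≢ wp u
    u≢u⁺ u≡u⁺ = u≢v (sym (x∈[a,a]⇒x≡a (subst (λ y → v ∈[ u , y ]) (sym u≡u⁺) v∈)))

    [u,u⁺]⊆N[u] : [ u , wp u ]⊆N[ u ]
    [u,u⁺]⊆N[u] = ∈[w,w⁺]⇒[w,x]⊆N[w] b∈[a,b]

    u∈N[u⁺] : u ∈N[ wp u ]
    u∈N[u⁺] = ∈N-sym ([u,u⁺]⊆N[u] b∈[a,b])

    ¬[u⁺,u]⊆N[u⁺] : ¬ [ wp u , u ]⊆N[ wp u ]
    ¬[u⁺,u]⊆N[u⁺] = ¬forward-cover u≢u⁺ [u,u⁺]⊆N[u]

    u⁺-reaches-back : [ u , wp u ]⊆N[ wp u ] → wp u ∈[ v , wp v ]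
    u⁺-reaches-back [u,u⁺]⊆ =
      Sum.[ ∈[v⁻,v]⇒∈[u,u⁺] , ⊥-elim ∘′ ¬[u⁺,u]⊆N[u⁺] ∘′ [u⁺,u]⊆ ]′ (∈N-split ([u,u⁺]⊆ v∈))
      where
      [u⁺,u]⊆ : v ∈[ wp u , wp (wp u) ] → [ wp u , u ]⊆N[ wp u ]
      [u⁺,u]⊆ v∈[u⁺,u⁺⁺] = ∈[w,w⁺]⇒[w,x]⊆N[w] (prefix-⊆ v∈[u⁺,u⁺⁺]
                             (∈[u,x]⇒∈[x,v] (∈[u,u⁺]⇒∈[v⁻,v] v∈[u⁺,u⁺⁺]) (∈[u,u⁺]⇒∈[v⁻,v] v∈) v∈ u⁺≢v))

module NeighArcs₃ {n} {G : Graph n} (¬co-bipartite : ¬ IsBipartite (CoAdj G))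
                 (σ : CircOrder n) (wm wp : Fin n → Fin n) (N[w]≡[w⁻,w⁺] : NeighArcs G σ wm wp) where

  open Arcs σ
  open Cliques G
  open NeighArcs₂ {G = G} ¬co-bipartite σ wm wp N[w]≡[w⁻,w⁺] public

  private
    module Mirror = NeighArcs₂ {G = G} ¬co-bipartite (reverse σ) wp wm reverse-neighArcs
    variable
      u v : Fin n

  ∈[u,u⁺]⇒v⁻∈[u⁻,u] : v ∈[ u , wp u ] → wm v ∈[ wm u , u ]
  ∈[u,u⁺]⇒v⁻∈[u⁻,u] {v} {u} v∈ =
    to ∈-reverse (Mirror.∈[u,u⁺]⇒u⁺∈[v,v⁺] {u} {v} (from ∈-reverse (∈[u,u⁺]⇒∈[v⁻,v] v∈)))

  module AdjacentSuccessor {u v} (u≺v : u ≺ v ⟨ σ ⟩) (adj : Adj G u v) where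

    consecutive : Consecutive u v
    consecutive = ≺⇒consecutive u≺v

    u≢v : u ≢ v
    u≢v = ≺⇒≢ u≺v

    [u,v]⊆N[u] : [ u , v ]⊆N[ u ]
    [u,v]⊆N[u] z∈ with consecutive z∈
    ... | inj₁ z≡u  = inj₁ z≡u
    ... | inj₂ refl = inj₂ adj

    u∉[v,v⁺] : u ∉[ v , wp v ]
    u∉[v,v⁺] u∈ = ¬forward-cover u≢v [u,v]⊆N[u] (∈[w,w⁺]⇒[w,x]⊆N[w] u∈)

    v∈[u,u⁺] : v ∈[ u , wp u ]
    v∈[u,u⁺] = Sum.[ ∈[v⁻,v]⇒∈[u,u⁺] , ⊥-elim ∘′ u∉[v,v⁺] ]′
                   (∈N-split (∈N-sym ([u,v]⊆N[u] b∈[a,b])))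

    v⁻∈[u⁻,u] : wm v ∈[ wm u , u ]
    v⁻∈[u⁻,u] = ∈[u,u⁺]⇒v⁻∈[u⁻,u] v∈[u,u⁺]

    u∈[u⁻,v] : u ∈[ wm u , v ]
    u∈[u⁻,v] = consecutive⇒∈[m,v] w∈[w⁻,w⁺] v∈[u,u⁺] u≢v consecutive

    v∈[u⁻,u⁺] : v ∈[ wm u , wp u ]
    v∈[u⁻,u⁺] = suffix-⊆ w∈[w⁻,w⁺] v∈[u,u⁺]

    u⁺∈[u⁻,v⁺] : wp u ∈[ wm u , wp v ]
    u⁺∈[u⁻,v⁺] with wp u ∈?[ wm u , wp v ]
    ... | yes u⁺∈ = u⁺∈
    ... | no u⁺∉  = ⊥-elim (¬backward-cover u⁻≢u [u⁻,u]⊆N[u] [u,u⁻]⊆N[u⁻])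
      where
      u⁻∈[v,v⁺] : wm u ∈[ v , wp v ]
      u⁻∈[v,v⁺] = consecutive⇒∈[v,q] (∈[u,u⁺]⇒u⁺∈[v,v⁺] v∈[u,u⁺]) u⁺∉ v∈[u⁻,u⁺] u∈[u⁻,v] consecutive

      u⁻≢u : wm u ≢ u
      u⁻≢u u⁻≡u = u∉[v,v⁺] (subst (_∈[ v , wp v ]) u⁻≡u u⁻∈[v,v⁺])

      [u⁻,u]⊆N[u] : [ wm u , u ]⊆N[ u ]
      [u⁻,u]⊆N[u] = ∈[w⁻,w]⇒[x,w]⊆N[w] a∈[a,b]

      [u,u⁻]⊆N[u⁻] : [ u , wm u ]⊆N[ wm u ]
      [u,u⁻]⊆N[u⁻] z∈ with ∈[u,m]⇒≡u⊎∈[v,m] u≢v consecutive z∈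
      ... | inj₁ refl     = ∈N-sym ([u⁻,u]⊆N[u] a∈[a,b])
      ... | inj₂ z∈[v,u⁻] = ∈[w⁻,w]⇒[x,w]⊆N[w] (∈[u,u⁺]⇒∈[v⁻,v] u⁻∈[v,v⁺]) z∈[v,u⁻]

    v∈[u⁻,v⁺] : v ∈[ wm u , wp v ]
    v∈[u⁻,v⁺] = prefix-⊆ u⁺∈[u⁻,v⁺] v∈[u⁻,u⁺]

    -- Otherwise [u⁻,u] and [v,v⁺] cover the circle; the former reach forward to u, the
    -- latter back to v.
    ¬consecutive : ¬ Consecutive (wp v) (wm u)
    ¬consecutive v⁺u⁻ =
      ¬co-bipartite (two-cliques⇒co-bipartite _ _ cover (reaching-to-clique u) (reaching-from-clique v))
      where
      cover : ∀ x → [ x , u ]⊆N[ x ] ⊎ [ v , x ]⊆N[ x ]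
      cover x with consecutive-cover u≢v consecutive v⁺u⁻ u∈[u⁻,v] v∈[u⁻,v⁺] x
      ... | inj₁ x∈[u⁻,u] = inj₁ (∈[w,w⁺]⇒[w,x]⊆N[w] (∈[v⁻,v]⇒∈[u,u⁺] x∈[u⁻,u]))
      ... | inj₂ x∈[v,v⁺] = inj₂ (∈[w⁻,w]⇒[x,w]⊆N[w] (∈[u,u⁺]⇒∈[v⁻,v] x∈[v,v⁺]))

    v⁺≢u⁻ : wp v ≢ wm u
    v⁺≢u⁻ v⁺≡u⁻ = ¬consecutive (subst (λ y → Consecutive y (wm u)) (sym v⁺≡u⁻) consecutive-refl)

    ¬v⁺≺u⁻ : ¬ (wp v ≺ wm u ⟨ σ ⟩)
    ¬v⁺≺u⁻ = ¬consecutive ∘ ≺⇒consecutive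


lemma3p5 : ∀ {n} (G : Graph n) → IsPCA G → ¬ IsBipartite (CoAdj G)
    → (σ : CircOrder n) → IsArcOrdering G σ
    → (wm wp : Fin n → Fin n) → NeighArcs G σ wm wp
    → (∀ u v → (v ∈[ u , wp u ]⟨ σ ⟩) ⇔ (u ∈[ wm v , v ]⟨ σ ⟩))
    × (∀ u v → v ∈[ u , wp u ]⟨ σ ⟩
         → (wm v ∈[ wm u , u ]⟨ σ ⟩) × (wp u ∈[ v , wp v ]⟨ σ ⟩))
    × (∀ u v → u ≺ v ⟨ σ ⟩ → Adj G u v
         → ((dist σ (wm u) (wm v) ≤ dist σ (wm u) u)
           × (dist σ (wm u) u ≤ dist σ (wm u) v)
           × (dist σ (wm u) v ≤ dist σ (wm u) (wp u))
           × (dist σ (wm u) (wp u) ≤ dist σ (wm u) (wp v))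
           × (wp v ≢ wm u))
           × ¬ (wp v ≺ wm u ⟨ σ ⟩))
lemma3p5 G _ ¬co-bipartite σ _ wm wp N[w]≡[w⁻,w⁺] =
    (λ u v → mk⇔ (⟨σ⟩ ∘′ ∈[u,u⁺]⇒∈[v⁻,v] ∘′ ⟨σ⟩⁻¹) (⟨σ⟩ ∘′ ∈[v⁻,v]⇒∈[u,u⁺] ∘′ ⟨σ⟩⁻¹))
  , (λ u v v∈ → ⟨σ⟩ (∈[u,u⁺]⇒v⁻∈[u⁻,u] (⟨σ⟩⁻¹ v∈)) , ⟨σ⟩ (∈[u,u⁺]⇒u⁺∈[v,v⁺] (⟨σ⟩⁻¹ v∈)))
  , (λ u v u≺v adj → let open AdjacentSuccessor u≺v adj in
       (⟨σ⟩ v⁻∈[u⁻,u] , ⟨σ⟩ u∈[u⁻,v] , ⟨σ⟩ v∈[u⁻,u⁺] , ⟨σ⟩ u⁺∈[u⁻,v⁺] , v⁺≢u⁻) , ¬v⁺≺u⁻)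
  where
  open Arcs σ
  open NeighArcs₃ {G = G} ¬co-bipartite σ wm wp N[w]≡[w⁻,w⁺]

  ⟨σ⟩ : ∀ {x a b} → x ∈[ a , b ] → x ∈[ a , b ]⟨ σ ⟩
  ⟨σ⟩ = to ∈⇔∈⟨σ⟩

  ⟨σ⟩⁻¹ : ∀ {x a b} → x ∈[ a , b ]⟨ σ ⟩ → x ∈[ a , b ]
  ⟨σ⟩⁻¹ = from ∈⇔∈⟨σ⟩
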